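{- If $G$ and $H$ are Left dead ends with $G\geq H$, then $\mathcal{T}(G)\subseteq\mathcal{T}(H)$.
   Context: All games are short partizan combinatorial game forms; $G+H$ is the disjunctive sum; $\cong$ denotes identity of game forms. Play is misère (a player unable to move wins). Misère outcome classes are ordered $\mathscr L>\mathscr P>\mathscr R$ and $\mathscr L>\mathscr N>\mathscr R$; $G\geq H$ means that for every game $X$ the misère outcome of $G+X$ is $\geq$ that of $H+X$. A Left dead end is a game no subposition of which (including itself) has a Left option; its options are its Right options. A run of length $k$ of $G$ is a sequence $(G_0,G_1,\dots,G_k)$ with $G_0\cong G$ and $G_{i+1}$ an option of $G_i$ for each $i$; it is terminal if $G_k\cong 0=\{\cdot\mid\cdot\}$. The set of terminal lengths $\mathcal{T}(G)$ is the set of all $n$ such that $G$ has a terminal run of length $n$. -}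

module Defs where

open import Data.Nat using (ℕ; zero; suc)
open import Data.Bool using (Bool; true; false; not; _∨_)
open import Data.List using (List; []; _∷_; _++_)
open import Data.List.Membership.Propositional using (_∈_)
open import Data.Sum using (_⊎_)
open import Relation.Binary.PropositionalEquality using (_≡_)
open import Relation.Binary.Construct.Closure.ReflexiveTransitive using (Star)

data Game : Set where
  mk : List Game → List Game → Game

leftOpts : Game → List Game
leftOpts (mk L R) = L

rightOpts : Game → List Game
rightOpts (mk L R) = R

zeroG : Game
zeroG = mk [] []

IsOption : Game → Game → Set
IsOption H G = (H ∈ leftOpts G) ⊎ (H ∈ rightOpts G)

OptionOf : Game → Game → Set
OptionOf G H = IsOption H G

Subposition : Game → Game → Set
Subposition H G = Star OptionOf G H

mutual
  infixl 6 _+_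
  _+_ : Game → Game → Game
  G@(mk GL GR) + H@(mk HL HR) =
    mk (sumL GL H ++ sumR G HL) (sumL GR H ++ sumR G HR)

  sumL : List Game → Game → List Game
  sumL [] H = []
  sumL (g ∷ gs) H = (g + H) ∷ sumL gs H

  sumR : Game → List Game → List Game
  sumR G [] = []
  sumR G (h ∷ hs) = (G + h) ∷ sumR G hs

-- Misère play: a player unable to move wins.

mutual
  leftWinsFirst : Game → Bool
  leftWinsFirst (mk [] R) = true
  leftWinsFirst (mk (g ∷ gs) R) = someRightLoses (g ∷ gs)

  rightWinsFirst : Game → Bool
  rightWinsFirst (mk L []) = true
  rightWinsFirst (mk L (g ∷ gs)) = someLeftLoses (g ∷ gs)

  someRightLoses : List Game → Bool
  someRightLoses [] = false
  someRightLoses (g ∷ gs) = not (rightWinsFirst g) ∨ someRightLoses gs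

  someLeftLoses : List Game → Bool
  someLeftLoses [] = false
  someLeftLoses (g ∷ gs) = not (leftWinsFirst g) ∨ someLeftLoses gs

data Outcome : Set where
  𝓛 𝓝 𝓟 𝓡 : Outcome

outcomeOf : Bool → Bool → Outcome
outcomeOf true  false = 𝓛
outcomeOf true  true  = 𝓝
outcomeOf false false = 𝓟
outcomeOf false true  = 𝓡

outcome : Game → Outcome
outcome G = outcomeOf (leftWinsFirst G) (rightWinsFirst G)

data _≥O_ : Outcome → Outcome → Set where
  refl≥ : ∀ {o} → o ≥O o
  L≥    : ∀ {o} → 𝓛 ≥O o
  ≥R    : ∀ {o} → o ≥O 𝓡

_≥G_ : Game → Game → Set
G ≥G H = ∀ X → outcome (G + X) ≥O outcome (H + X)

LeftDeadEnd : Game → Set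
LeftDeadEnd G = ∀ H → Subposition H G → leftOpts H ≡ []

data TerminalRun : Game → ℕ → Set where
  stop : ∀ {G} → G ≡ zeroG → TerminalRun G zero
  step : ∀ {G G′ k} → IsOption G′ G → TerminalRun G′ k → TerminalRun G (suc k)

𝒯 : Game → ℕ → Set
𝒯 G n = TerminalRun G n

{-# OPTIONS --safe #-}
-- Probe with X₀ = 0 and Xₙ₊₁ = {Xₙ | 0}. For a Left dead end K, in K + Xₙ Left can only
-- count X down, while Right must move in K: his alternative X ↦ 0 leaves Left without
-- a move, which wins for her. So Right, moving first, wins K + Xₙ exactly when K has a
-- terminal run of length n. The outcomes in which Right wins moving first (𝓝 and 𝓡)
-- form a down-set of ≥O, so G ≥ H transfers this from G + Xₙ to H + Xₙ.

module Submission where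

open import Defs
open import Data.Nat using (ℕ; zero; suc)
open import Data.Bool using (true; false; not; _∨_)
open import Data.Bool.Properties using (∨-assoc; ∨-identityʳ; not-injective)
open import Data.List using ([]; _∷_; _++_; map)
open import Data.List.Properties using (++-identityʳ)
open import Data.List.Membership.Propositional using (_∈_)
open import Data.List.Membership.Propositional.Properties using (Any↔)
open import Data.List.Relation.Unary.Any using (Any; here; there)
open import Data.List.Relation.Unary.Any.Properties using (map↔)
open import Data.List.Relation.Unary.All as All using (All; []; _∷_)
open import Data.Product using (∃-syntax; _×_; _,_)
open import Data.Sum using (inj₁; inj₂)
open import Relation.Nullary using (contradiction)
open import Function using (_∘_; _⇔_; mk⇔; Equivalence)
open import Function.Related.Propositional using (equivalence; module EquationalReasoning)
open import Relation.Binary.Construct.Closure.ReflexiveTransitive using (ε; _◅_)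
open import Relation.Binary.PropositionalEquality using (_≡_; refl; cong; cong₂; trans; sym; module ≡-Reasoning)
open import Function.Properties.Equivalence using () renaming (sym to ⇔-sym)

open Equivalence using (to; from)

mutual
  +-identityʳ : ∀ G → G + zeroG ≡ G
  +-identityʳ (mk L R) =
    cong₂ mk (trans (++-identityʳ _) (sumL-zeroG L)) (trans (++-identityʳ _) (sumL-zeroG R))

  sumL-zeroG : ∀ gs → sumL gs zeroG ≡ gs
  sumL-zeroG [] = refl
  sumL-zeroG (g ∷ gs) = cong₂ _∷_ (+-identityʳ g) (sumL-zeroG gs)

sumL≡map : ∀ gs H → sumL gs H ≡ map (_+ H) gs
sumL≡map [] H = refl
sumL≡map (g ∷ gs) H = cong (g + H ∷_) (sumL≡map gs H)

LeftDeadEnd⇒leftOpts≡[] : ∀ {G} → LeftDeadEnd G → leftOpts G ≡ []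
LeftDeadEnd⇒leftOpts≡[] dG = dG _ ε

LeftDeadEnd-rightOpt : ∀ {G H} → LeftDeadEnd G → H ∈ rightOpts G → LeftDeadEnd H
LeftDeadEnd-rightOpt dG H∈R K K≤H = dG K (inj₂ H∈R ◅ K≤H)

TerminalRun-zero⇔ : ∀ {G} → TerminalRun G zero ⇔ G ≡ zeroG
TerminalRun-zero⇔ = mk⇔ (λ { (stop G≡0) → G≡0 }) stop

TerminalRun-suc⇔ : ∀ {R k} → TerminalRun (mk [] R) (suc k) ⇔ (∃[ G ] G ∈ R × TerminalRun G k)
TerminalRun-suc⇔ = mk⇔ (λ { (step (inj₁ ()) _) ; (step (inj₂ G∈R) run) → _ , G∈R , run })
                       (λ (_ , G∈R , run) → step (inj₂ G∈R) run)

∃∈-cong : ∀ {A : Set} {P Q : A → Set} {xs} → (∀ {x} → x ∈ xs → P x ⇔ Q x) →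
          (∃[ x ] x ∈ xs × P x) ⇔ (∃[ x ] x ∈ xs × Q x)
∃∈-cong P⇔Q = mk⇔ (λ (x , x∈xs , p) → x , x∈xs , to (P⇔Q x∈xs) p)
                  (λ (x , x∈xs , q) → x , x∈xs , from (P⇔Q x∈xs) q)

not≡false⇔≡true : ∀ {b} → not b ≡ false ⇔ b ≡ true
not≡false⇔≡true = mk⇔ not-injective (cong not)

someLeftLoses≡true⇔ : ∀ gs → someLeftLoses gs ≡ true ⇔ Any (λ g → leftWinsFirst g ≡ false) gs
someLeftLoses≡true⇔ [] = mk⇔ (λ ()) (λ ())
someLeftLoses≡true⇔ (g ∷ gs) with leftWinsFirst g in won
... | false = mk⇔ (λ _ → here won) (λ _ → refl)
... | true  = mk⇔ (there ∘ to (someLeftLoses≡true⇔ gs))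
                  (λ { (here lost) → contradiction (trans (sym won) lost) λ ()
                     ; (there lost) → from (someLeftLoses≡true⇔ gs) lost })

someLeftLoses-++ : ∀ xs ys → someLeftLoses (xs ++ ys) ≡ someLeftLoses xs ∨ someLeftLoses ys
someLeftLoses-++ [] ys = refl
someLeftLoses-++ (x ∷ xs) ys =
  trans (cong (not (leftWinsFirst x) ∨_) (someLeftLoses-++ xs ys))
        (sym (∨-assoc (not (leftWinsFirst x)) _ _))

someLeftLoses-noLeftOpts : ∀ {gs} → All (λ g → leftOpts g ≡ []) gs → someLeftLoses gs ≡ false
someLeftLoses-noLeftOpts [] = refl
someLeftLoses-noLeftOpts {mk [] _ ∷ _} (refl ∷ noLeft) = someLeftLoses-noLeftOpts noLeft

rightWinsFirst-++-∷ : ∀ L xs y ys → rightWinsFirst (mk L (xs ++ y ∷ ys)) ≡ someLeftLoses (xs ++ y ∷ ys)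
rightWinsFirst-++-∷ L [] y ys = refl
rightWinsFirst-++-∷ L (x ∷ xs) y ys = refl

≥O⇒rightWinsFirst : ∀ {l₁ r₁ l₂ r₂} → outcomeOf l₁ r₁ ≥O outcomeOf l₂ r₂ → r₁ ≡ true → r₂ ≡ true
≥O⇒rightWinsFirst {r₂ = true} _ _ = refl
≥O⇒rightWinsFirst {true}  {true} {true}  {false} () refl
≥O⇒rightWinsFirst {true}  {true} {false} {false} () refl
≥O⇒rightWinsFirst {false} {true} {true}  {false} () refl
≥O⇒rightWinsFirst {false} {true} {false} {false} () refl

rightWinsFirst-LeftDeadEnd : ∀ {G} → LeftDeadEnd G → rightWinsFirst G ≡ true ⇔ G ≡ zeroG
rightWinsFirst-LeftDeadEnd {mk L []} dG with refl ← LeftDeadEnd⇒leftOpts≡[] dG =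
  mk⇔ (λ _ → refl) (λ _ → refl)
rightWinsFirst-LeftDeadEnd {mk L (_ ∷ _)} dG
  rewrite someLeftLoses-noLeftOpts (All.tabulate (LeftDeadEnd⇒leftOpts≡[] ∘ LeftDeadEnd-rightOpt dG)) =
  mk⇔ (λ ()) (λ ())

probe : ℕ → Game
probe zero = zeroG
probe (suc j) = mk (probe j ∷ []) (zeroG ∷ [])

leftWinsFirst-+probe-suc : ∀ R j →
  leftWinsFirst (mk [] R + probe (suc j)) ≡ not (rightWinsFirst (mk [] R + probe j))
leftWinsFirst-+probe-suc R j = ∨-identityʳ _

rightWinsFirst-+probe-suc : ∀ R j →
  rightWinsFirst (mk [] R + probe (suc j)) ≡ someLeftLoses (sumL R (probe (suc j)))
rightWinsFirst-+probe-suc R j = begin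
  rightWinsFirst (mk [] R + P)                        ≡⟨ rightWinsFirst-++-∷ _ (sumL R P) (mk [] R + zeroG) [] ⟩
  someLeftLoses (sumL R P ++ (mk [] R + zeroG) ∷ [])  ≡⟨ someLeftLoses-++ (sumL R P) _ ⟩
  someLeftLoses (sumL R P) ∨ false                    ≡⟨ ∨-identityʳ _ ⟩
  someLeftLoses (sumL R P)                            ∎
  where
  open ≡-Reasoning
  P : Game
  P = probe (suc j)

rightWinsFirst-+probe⇔TerminalRun : ∀ {G} → LeftDeadEnd G → ∀ n →
  rightWinsFirst (G + probe n) ≡ true ⇔ TerminalRun G n
rightWinsFirst-+probe⇔TerminalRun {G} dG zero = begin
  (rightWinsFirst (G + zeroG) ≡ true) ≡⟨ cong (λ H → rightWinsFirst H ≡ true) (+-identityʳ G) ⟩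
  (rightWinsFirst G ≡ true)           ∼⟨ rightWinsFirst-LeftDeadEnd dG ⟩
  (G ≡ zeroG)                         ∼⟨ ⇔-sym TerminalRun-zero⇔ ⟩
  TerminalRun G zero                  ∎
  where open EquationalReasoning {k = equivalence}
rightWinsFirst-+probe⇔TerminalRun {mk L R} dG (suc j) with refl ← LeftDeadEnd⇒leftOpts≡[] dG = begin
  (rightWinsFirst (mk [] R + P) ≡ true)                 ≡⟨ cong (_≡ true) (rightWinsFirst-+probe-suc R j) ⟩
  (someLeftLoses (sumL R P) ≡ true)                     ∼⟨ someLeftLoses≡true⇔ (sumL R P) ⟩
  Any (λ H → leftWinsFirst H ≡ false) (sumL R P)        ≡⟨ cong (Any _) (sumL≡map R P) ⟩
  Any (λ H → leftWinsFirst H ≡ false) (map (_+ P) R)    ↔⟨ map↔ ⟨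
  Any (λ H → leftWinsFirst (H + P) ≡ false) R           ↔⟨ Any↔ ⟨
  (∃[ H ] H ∈ R × leftWinsFirst (H + P) ≡ false)        ∼⟨ ∃∈-cong (λ H∈R → lost⇔run (LeftDeadEnd-rightOpt dG H∈R)) ⟩
  (∃[ H ] H ∈ R × TerminalRun H j)                      ∼⟨ ⇔-sym TerminalRun-suc⇔ ⟩
  TerminalRun (mk [] R) (suc j)                         ∎
  where
  open EquationalReasoning {k = equivalence}
  P : Game
  P = probe (suc j)

  lost⇔run : ∀ {H} → LeftDeadEnd H → leftWinsFirst (H + P) ≡ false ⇔ TerminalRun H j
  lost⇔run {mk L′ R′} dH with refl ← LeftDeadEnd⇒leftOpts≡[] dH = begin
    (leftWinsFirst (mk [] R′ + P) ≡ false)              ≡⟨ cong (_≡ false) (leftWinsFirst-+probe-suc R′ j) ⟩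
    (not (rightWinsFirst (mk [] R′ + probe j)) ≡ false) ∼⟨ not≡false⇔≡true ⟩
    (rightWinsFirst (mk [] R′ + probe j) ≡ true)        ∼⟨ rightWinsFirst-+probe⇔TerminalRun dH j ⟩
    TerminalRun (mk [] R′) j                            ∎

mainTheorem4 : (G H : Game) → LeftDeadEnd G → LeftDeadEnd H → G ≥G H →
    (n : ℕ) → 𝒯 G n → 𝒯 H n
mainTheorem4 G H dG dH G≥H n =
  to (rightWinsFirst-+probe⇔TerminalRun dH n)
  ∘ ≥O⇒rightWinsFirst (G≥H (probe n))
  ∘ from (rightWinsFirst-+probe⇔TerminalRun dG n)
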